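{- Let $(A,\rightarrow,\rightsquigarrow,1)$ be a pseudo BCK-algebra and $\mu$ a type II state operator on $A$. Then: (1) $y\le x$ implies $\mu(x\rightarrow y)=\mu(x)\rightarrow\mu(y)$ and $\mu(x\rightsquigarrow y)=\mu(x)\rightsquigarrow\mu(y)$; (2) $x\rightarrow y\in{\rm Ker}(\mu)$ iff $((y\rightarrow x)\rightsquigarrow x)\rightarrow y\in{\rm Ker}(\mu)$; (3) $x\rightsquigarrow y\in{\rm Ker}(\mu)$ iff $((y\rightsquigarrow x)\rightarrow x)\rightsquigarrow y\in{\rm Ker}(\mu)$; (4) ${\rm Ker}(\mu)$ is a commutative deductive system of $A$.
   Context: A pseudo BCK-algebra is an algebra $(A,\rightarrow,\rightsquigarrow,1)$ of type $(2,2,0)$ such that for all $x,y,z\in A$: $(x\rightarrow y)\rightsquigarrow[(y\rightarrow z)\rightsquigarrow(x\rightarrow z)]=1$; $(x\rightsquigarrow y)\rightarrow[(y\rightsquigarrow z)\rightarrow(x\rightsquigarrow z)]=1$; $1\rightarrow x=x$; $1\rightsquigarrow x=x$; $x\rightarrow 1=1$; and if $x\rightarrow y=1$ and $y\rightarrow x=1$ then $x=y$. The order is $x\le y$ iff $x\rightarrow y=1$ (iff $x\rightsquigarrow y=1$). A deductive system is a subset $D$ with $1\in D$ such that $x, x\rightarrow y\in D$ imply $y\in D$; it is commutative if $y\rightarrow x\in D$ implies $((x\rightarrow y)\rightsquigarrow y)\rightarrow x\in D$ and $y\rightsquigarrow x\in D$ implies $((x\rightsquigarrow y)\rightarrow y)\rightsquigarrow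 x\in D$. A type II state operator is a map $\mu:A\to A$ such that for all $x,y\in A$: $x\le y$ implies $\mu(x)\le\mu(y)$; $\mu(x\rightarrow y)=\mu((y\rightarrow x)\rightsquigarrow x)\rightarrow\mu(y)$ and $\mu(x\rightsquigarrow y)=\mu((y\rightsquigarrow x)\rightarrow x)\rightsquigarrow\mu(y)$; $\mu(\mu(x)\rightarrow\mu(y))=\mu(x)\rightarrow\mu(y)$ and $\mu(\mu(x)\rightsquigarrow\mu(y))=\mu(x)\rightsquigarrow\mu(y)$. ${\rm Ker}(\mu)=\{x\in A\mid\mu(x)=1\}$. -}

module Defs where

open import Level using (Level; suc; _⊔_)
open import Data.Product using (_×_)
open import Relation.Binary.PropositionalEquality using (_≡_)
open import Relation.Unary using (Pred; _∈_)

record PseudoBCK (a : Level) : Set (suc a) where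
  infixr 5 _⇒_ _⇝_
  field
    Carrier : Set a
    _⇒_     : Carrier → Carrier → Carrier
    _⇝_     : Carrier → Carrier → Carrier
    𝟙       : Carrier
    ax1 : ∀ x y z → ((x ⇒ y) ⇝ ((y ⇒ z) ⇝ (x ⇒ z))) ≡ 𝟙
    ax2 : ∀ x y z → ((x ⇝ y) ⇒ ((y ⇝ z) ⇒ (x ⇝ z))) ≡ 𝟙
    ax3 : ∀ x → (𝟙 ⇒ x) ≡ x
    ax4 : ∀ x → (𝟙 ⇝ x) ≡ x
    ax5 : ∀ x → (x ⇒ 𝟙) ≡ 𝟙
    ax6 : ∀ x y → (x ⇒ y) ≡ 𝟙 → (y ⇒ x) ≡ 𝟙 → x ≡ y

  _≤_ : Carrier → Carrier → Set a
  x ≤ y = (x ⇒ y) ≡ 𝟙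

module _ {a : Level} (A : PseudoBCK a) where
  open PseudoBCK A

  record IsStateII (μ : Carrier → Carrier) : Set a where
    field
      mono : ∀ x y → x ≤ y → μ x ≤ μ y
      st⇒  : ∀ x y → μ (x ⇒ y) ≡ (μ ((y ⇒ x) ⇝ x) ⇒ μ y)
      st⇝  : ∀ x y → μ (x ⇝ y) ≡ (μ ((y ⇝ x) ⇒ x) ⇝ μ y)
      idem⇒ : ∀ x y → μ (μ x ⇒ μ y) ≡ (μ x ⇒ μ y)
      idem⇝ : ∀ x y → μ (μ x ⇝ μ y) ≡ (μ x ⇝ μ y)

  Ker : (Carrier → Carrier) → Pred Carrier a
  Ker μ x = μ x ≡ 𝟙

  record IsDeductiveSystem (D : Pred Carrier a) : Set a where
    field
      one∈ : 𝟙 ∈ D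
      mp   : ∀ x y → x ∈ D → (x ⇒ y) ∈ D → y ∈ D

  record IsCommutativeDS (D : Pred Carrier a) : Set a where
    field
      isDS : IsDeductiveSystem D
      comm⇒ : ∀ x y → (y ⇒ x) ∈ D → (((x ⇒ y) ⇝ y) ⇒ x) ∈ D
      comm⇝ : ∀ x y → (y ⇝ x) ∈ D → (((x ⇝ y) ⇒ y) ⇝ x) ∈ D

-- Since y ≤ (y → x) ⇝ x, the state axiom μ(x → y) = μ((y → x) ⇝ x) → μ(y) says, by (1),
-- that μ(x → y) = μ(((y → x) ⇝ x) → y); (2), (3) and the commutativity of Ker(μ) are
-- immediate from this and its ⇝-twin.  Ker(μ) is closed under modus ponens because it is
-- an upset containing (y → x) ⇝ x ≥ x whenever it contains x, and the state axiom then
-- reads μ(x → y) = 1 → μ(y).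
module Submission where

open import Defs
open import Level using (Level)
open import Data.Product using (_×_; _,_)
open import Relation.Binary.PropositionalEquality
  using (_≡_; sym; trans; cong; subst; module ≡-Reasoning)
open import Relation.Unary using (_∈_)
open import Function.Bundles using (_⇔_; mk⇔; Equivalence)

module PseudoBCKProperties {a : Level} (A : PseudoBCK a) where
  open PseudoBCK A

  x⇝[x⇒y]⇝y≡𝟙 : ∀ x y → (x ⇝ ((x ⇒ y) ⇝ y)) ≡ 𝟙
  x⇝[x⇒y]⇝y≡𝟙 x y with ax1 𝟙 x y
  ... | e rewrite ax3 x | ax3 y = e

  x≤[x⇝y]⇒y : ∀ x y → x ≤ ((x ⇝ y) ⇒ y)
  x≤[x⇝y]⇒y x y with ax2 𝟙 x y
  ... | e rewrite ax4 x | ax4 y = e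

  ≤-refl : ∀ x → x ≤ x
  ≤-refl x with x≤[x⇝y]⇒y 𝟙 x
  ... | e rewrite ax4 x | ax3 (x ⇒ x) = e

  𝟙≤⇒≡𝟙 : ∀ {x} → 𝟙 ≤ x → x ≡ 𝟙
  𝟙≤⇒≡𝟙 {x} = trans (sym (ax3 x))

  ⇒≡𝟙⇒⇝≡𝟙 : ∀ {x y} → (x ⇒ y) ≡ 𝟙 → (x ⇝ y) ≡ 𝟙
  ⇒≡𝟙⇒⇝≡𝟙 {x} {y} x⇒y≡𝟙 with x⇝[x⇒y]⇝y≡𝟙 x y
  ... | e rewrite x⇒y≡𝟙 | ax4 y = e

  ⇝≡𝟙⇒⇒≡𝟙 : ∀ {x y} → (x ⇝ y) ≡ 𝟙 → (x ⇒ y) ≡ 𝟙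
  ⇝≡𝟙⇒⇒≡𝟙 {x} {y} x⇝y≡𝟙 with x≤[x⇝y]⇒y x y
  ... | e rewrite x⇝y≡𝟙 | ax3 y = e

  x≤[x⇒y]⇝y : ∀ x y → x ≤ ((x ⇒ y) ⇝ y)
  x≤[x⇒y]⇝y x y = ⇝≡𝟙⇒⇒≡𝟙 (x⇝[x⇒y]⇝y≡𝟙 x y)

  ⇝-antitoneˡ : ∀ {x y} z → x ≤ y → (y ⇝ z) ≤ (x ⇝ z)
  ⇝-antitoneˡ {x} {y} z x≤y with ax2 x y z
  ... | e rewrite ⇒≡𝟙⇒⇝≡𝟙 x≤y | ax3 ((y ⇝ z) ⇒ (x ⇝ z)) = e

  x≤[y⇒x]⇝x : ∀ x y → x ≤ ((y ⇒ x) ⇝ x)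
  x≤[y⇒x]⇝x x y with ⇝-antitoneˡ x (ax5 (y ⇒ x))
  ... | e rewrite ax4 x = e

module StateIIProperties {a : Level} {A : PseudoBCK a} {μ : PseudoBCK.Carrier A → PseudoBCK.Carrier A}
                         (st : IsStateII A μ) where
  open PseudoBCK A
  open PseudoBCKProperties A
  open IsStateII st
  open ≡-Reasoning

  μ-⇒-≥ : ∀ {x y} → y ≤ x → μ (x ⇒ y) ≡ (μ x ⇒ μ y)
  μ-⇒-≥ {x} {y} y≤x = begin
    μ (x ⇒ y)              ≡⟨ st⇒ x y ⟩
    μ ((y ⇒ x) ⇝ x) ⇒ μ y  ≡⟨ cong (λ z → μ (z ⇝ x) ⇒ μ y) y≤x ⟩
    μ (𝟙 ⇝ x) ⇒ μ y        ≡⟨ cong (λ z → μ z ⇒ μ y) (ax4 x) ⟩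
    μ x ⇒ μ y              ∎

  μ-⇝-≥ : ∀ {x y} → y ≤ x → μ (x ⇝ y) ≡ (μ x ⇝ μ y)
  μ-⇝-≥ {x} {y} y≤x = begin
    μ (x ⇝ y)              ≡⟨ st⇝ x y ⟩
    μ ((y ⇝ x) ⇒ x) ⇝ μ y  ≡⟨ cong (λ z → μ (z ⇒ x) ⇝ μ y) (⇒≡𝟙⇒⇝≡𝟙 y≤x) ⟩
    μ (𝟙 ⇒ x) ⇝ μ y        ≡⟨ cong (λ z → μ z ⇝ μ y) (ax3 x) ⟩
    μ x ⇝ μ y              ∎

  μ-⇒-commute : ∀ x y → μ (x ⇒ y) ≡ μ (((y ⇒ x) ⇝ x) ⇒ y)
  μ-⇒-commute x y = begin
    μ (x ⇒ y)              ≡⟨ st⇒ x y ⟩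
    μ ((y ⇒ x) ⇝ x) ⇒ μ y  ≡⟨ sym (μ-⇒-≥ (x≤[x⇒y]⇝y y x)) ⟩
    μ (((y ⇒ x) ⇝ x) ⇒ y)  ∎

  μ-⇝-commute : ∀ x y → μ (x ⇝ y) ≡ μ (((y ⇝ x) ⇒ x) ⇝ y)
  μ-⇝-commute x y = begin
    μ (x ⇝ y)              ≡⟨ st⇝ x y ⟩
    μ ((y ⇝ x) ⇒ x) ⇝ μ y  ≡⟨ sym (μ-⇝-≥ (x≤[x⇝y]⇒y y x)) ⟩
    μ (((y ⇝ x) ⇒ x) ⇝ y)  ∎

  Ker-resp-μ : ∀ {x y} → μ x ≡ μ y → x ∈ Ker A μ ⇔ y ∈ Ker A μ
  Ker-resp-μ μx≡μy = mk⇔ (trans (sym μx≡μy)) (trans μx≡μy)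

  μ-𝟙 : μ 𝟙 ≡ 𝟙
  μ-𝟙 = begin
    μ 𝟙          ≡⟨ cong μ (sym (ax3 𝟙)) ⟩
    μ (𝟙 ⇒ 𝟙)    ≡⟨ μ-⇒-≥ (ax5 𝟙) ⟩
    μ 𝟙 ⇒ μ 𝟙    ≡⟨ ≤-refl (μ 𝟙) ⟩
    𝟙            ∎

  Ker-upward : ∀ {x y} → x ≤ y → x ∈ Ker A μ → y ∈ Ker A μ
  Ker-upward {x} {y} x≤y μx≡𝟙 = 𝟙≤⇒≡𝟙 (subst (_≤ μ y) μx≡𝟙 (mono x y x≤y))

  Ker-mp : ∀ x y → x ∈ Ker A μ → (x ⇒ y) ∈ Ker A μ → y ∈ Ker A μ
  Ker-mp x y μx≡𝟙 μ[x⇒y]≡𝟙 = begin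
    μ y                    ≡⟨ sym (ax3 (μ y)) ⟩
    𝟙 ⇒ μ y                ≡⟨ cong (_⇒ μ y) (sym (Ker-upward (x≤[y⇒x]⇝x x y) μx≡𝟙)) ⟩
    μ ((y ⇒ x) ⇝ x) ⇒ μ y  ≡⟨ sym (st⇒ x y) ⟩
    μ (x ⇒ y)              ≡⟨ μ[x⇒y]≡𝟙 ⟩
    𝟙                      ∎

  Ker-isDeductiveSystem : IsDeductiveSystem A (Ker A μ)
  Ker-isDeductiveSystem = record { one∈ = μ-𝟙 ; mp = Ker-mp }

proposition5p7 : {a : Level} (A : PseudoBCK a) (μ : PseudoBCK.Carrier A → PseudoBCK.Carrier A) → IsStateII A μ →
    let open PseudoBCK A in
    (∀ x y → y ≤ x → (μ (x ⇒ y) ≡ (μ x ⇒ μ y)) × (μ (x ⇝ y) ≡ (μ x ⇝ μ y)))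
    × (∀ x y → ((x ⇒ y) ∈ Ker A μ) ⇔ ((((y ⇒ x) ⇝ x) ⇒ y) ∈ Ker A μ))
    × (∀ x y → ((x ⇝ y) ∈ Ker A μ) ⇔ ((((y ⇝ x) ⇒ x) ⇝ y) ∈ Ker A μ))
    × IsCommutativeDS A (Ker A μ)
proposition5p7 A μ st =
    (λ x y y≤x → μ-⇒-≥ y≤x , μ-⇝-≥ y≤x)
  , (λ x y → Ker-resp-μ (μ-⇒-commute x y))
  , (λ x y → Ker-resp-μ (μ-⇝-commute x y))
  , record
      { isDS  = Ker-isDeductiveSystem
      ; comm⇒ = λ x y → Equivalence.to (Ker-resp-μ (μ-⇒-commute y x))
      ; comm⇝ = λ x y → Equivalence.to (Ker-resp-μ (μ-⇝-commute y x))
      }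
  where open StateIIProperties st
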